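{- Let $G$ be a finite simple graph without isolated vertices, with vertices $v_1,\dots,v_n$, and let $f_j=\mathrm{dp}(v_j)$ for $1\le j\le n$ (the terms of the degree polynomial sequence of $G$). Then: (a) $\sum_{j=1}^{n}\mathrm{sc}(f_j)$ is even; (b) for every vertex $v$ and every essential term $k x^{i}$ ($k\neq 0$) of $\mathrm{dp}(v)$, there exist at least $k$ distinct vertices $w_1,\dots,w_k$, all distinct from $v$, such that $\mathrm{sc}(\mathrm{dp}(w_1))=\dots=\mathrm{sc}(\mathrm{dp}(w_k))=i$; (c) both $\sum_{j:\ \mathrm{sc}(f_j)\text{ odd}}\mathrm{sec}(f_j)$ and $\sum_{j:\ \mathrm{sc}(f_j)\text{ even}}\mathrm{sec}(f_j)$ are even integers.
   Context: For a vertex $v$ of a simple graph $G$, the degree polynomial $\mathrm{dp}(v)$ is the polynomial whose coefficient of $x^{i}$ is the number of neighbours of $v$ having degree $i$ in $G$. For a polynomial $f=\sum_i a_i x^i$ with integer coefficients, $\mathrm{sc}(f)$ denotes the sum of all its coefficients (with $\mathrm{sc}(0)=0$), $\mathrm{sec}(f)$ the sum of the coefficients $a_i$ with $i$ even, and $\mathrm{soc}(f)$ the sum of the coefficients $a_i$ with $i$ odd. An essential term of $f$ is a term $a_i x^i$ with $a_i\neq 0$. -}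

module Defs where

open import Data.Nat using (ℕ; zero; suc; _+_; _∸_)
open import Data.Nat.Divisibility using (_∣_; _∣?_)
open import Data.Bool using (Bool; true; false; if_then_else_; T)
open import Data.Fin using (Fin)
open import Data.Nat.ListAction using (sum)
open import Relation.Nullary.Decidable using (T?)
open import Data.Nat using (_≟_)
open import Data.List using (List; []; _∷_; map; upTo; allFin; filter; length; lookup)
open import Data.Product using (Σ; _×_; ∃)
open import Relation.Nullary using (¬_; does)
open import Relation.Binary.PropositionalEquality using (_≡_; _≢_)

record SimpleGraph (n : ℕ) : Set where
  field
    adj       : Fin n → Fin n → Bool
    adj-sym   : ∀ u v → adj u v ≡ adj v u
    adj-irrefl : ∀ v → adj v v ≡ false
open SimpleGraph public

-- Integer polynomials with nonnegative coefficients, as coefficient lists: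
-- the i-th list entry is the coefficient of x^i.
Poly : Set
Poly = List ℕ

coeff : Poly → ℕ → ℕ
coeff []       _       = 0
coeff (a ∷ f)  zero    = a
coeff (a ∷ f)  (suc i) = coeff f i

sc : Poly → ℕ
sc = sum

sec : Poly → ℕ
soc : Poly → ℕ
sec []      = 0
sec (a ∷ f) = a + soc f
soc []      = 0
soc (a ∷ f) = sec f

module _ {n : ℕ} (G : SimpleGraph n) where

  neighbours : Fin n → List (Fin n)
  neighbours v = filter (λ w → T? (adj G v w)) (allFin n)

  degree : Fin n → ℕ
  degree v = length (neighbours v)

  -- degree polynomial: coefficient of x^i = #neighbours of v of degree i
  -- (degrees are < n, so exponents 0..n-1 suffice)
  dp : Fin n → Poly
  dp v = map (λ i → length (filter (λ w → degree w ≟ i) (neighbours v))) (upTo n)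

  NoIsolated : Set
  NoIsolated = ∀ v → Σ (Fin n) λ w → T (adj G v w)

sumOver : {n : ℕ} → (Fin n → Bool) → (Fin n → ℕ) → ℕ
sumOver {n} p g = sum (map (λ j → if p j then g j else 0) (allFin n))

isEven : ℕ → Bool
isEven m = does (2 ∣? m)

-- The coefficient of x^i in dp(v) counts the neighbours of v of degree i. Weighting it by g(i) and
-- summing over i therefore gives the sum of g(deg w) over the neighbours w of v, so sc(dp v) = deg v
-- and sec(dp v) is the number of even-degree neighbours of v. Part (a) is then the handshake lemma,
-- and part (b) lists the neighbours of v of degree i. For (c), summed over the even-degree vertices
-- the number of even-degree neighbours counts every edge between even-degree vertices twice. Summed
-- over the odd-degree vertices it equals their degree sum minus twice the number of edges between
-- odd-degree vertices, and that degree sum is even because the total one and every even degree are.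
module Submission where

open import Defs
open import Data.Nat using (ℕ)
open import Data.Nat.Divisibility using (_∣_)
open import Data.Bool using (Bool; not; T)
open import Data.Fin using (Fin)
open import Data.Nat.ListAction using (sum)
open import Data.List using (map; allFin)
open import Data.Product using (Σ; _×_)
open import Function.Definitions using (Injective)
open import Relation.Binary.PropositionalEquality using (_≡_; _≢_)

open import Data.Bool using (true; false; if_then_else_)
open import Data.Bool.Properties using (not-involutive)
open import Data.Empty using (⊥-elim)
open import Data.Fin using (zero; suc; toℕ)
open import Data.List using (List; []; _∷_; applyUpTo; tabulate; filter; length; lookup)
open import Data.List.Membership.Propositional using (_∈_)
open import Data.List.Membership.Propositional.Properties using (∈-allFin; ∈-filter⁻; ∈-lookup)
open import Data.List.Properties using (map-tabulate; map-upTo; length-tabulate; filter-notAll)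
open import Data.List.Relation.Unary.AllPairs using (_∷_)
open import Data.List.Relation.Unary.Any as Any using ()
open import Data.List.Relation.Unary.Unique.Propositional using (Unique)
open import Data.List.Relation.Unary.Unique.Propositional.Properties using (allFin⁺; filter⁺)
import Data.List.Relation.Unary.All as All
open import Data.Nat using (zero; suc; _+_; _*_; _≤_; _<_; _≟_; _<?_; s≤s)
open import Data.Nat.Divisibility using (divides; _∣?_; ∣-refl; ∣m∣n⇒∣m+n; ∣m+n∣m⇒∣n; ∣1⇒≡1; ∣n⇒∣m*n)
open import Data.Nat.Properties
  using (+-*-semiring; *-commutativeSemigroup; +-assoc; +-comm; +-identityʳ; *-comm;
         *-identityʳ; *-zeroʳ; *-suc; *-distribˡ-+; ≮⇒≥)
open import Algebra.Properties.CommutativeSemigroup *-commutativeSemigroup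
  using (x∙yz≈y∙xz; x∙yz≈z∙yx)
open import Algebra.Properties.Semiring.Sum +-*-semiring
  using (sum-syntax; sum-cong-≗; sum-replicate-zero; ∑-distrib-+; ∑-comm; *-distribˡ-sum)
open import Data.Product using (_,_; proj₁; proj₂)
open import Data.Sum using (_⊎_; inj₁; inj₂)
open import Function using (_∘_)
open import Relation.Nullary using (¬_; yes; no; does)
open import Relation.Nullary.Decidable using (T?; dec-true; dec-false)
open import Relation.Unary using (Decidable)
open import Relation.Binary.PropositionalEquality
  using (refl; sym; trans; cong; cong₂; subst; module ≡-Reasoning)

⟦_⟧ : Bool → ℕ
⟦ b ⟧ = if b then 1 else 0

if-then-0≡⟦⟧* : ∀ b x → (if b then x else 0) ≡ ⟦ b ⟧ * x
if-then-0≡⟦⟧* true  x = sym (+-identityʳ x)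
if-then-0≡⟦⟧* false x = refl

⟦⟧*-split : ∀ b x → x ≡ ⟦ b ⟧ * x + ⟦ not b ⟧ * x
⟦⟧*-split true  x = sym (trans (+-identityʳ (x + 0)) (+-identityʳ x))
⟦⟧*-split false x = sym (+-identityʳ x)

even-or-odd : ∀ m → 2 ∣ m ⊎ 2 ∣ suc m
even-or-odd zero = inj₁ (divides 0 refl)
even-or-odd (suc m) with even-or-odd m
... | inj₁ 2∣m   = inj₂ (∣m∣n⇒∣m+n ∣-refl 2∣m)
... | inj₂ 2∣1+m = inj₁ 2∣1+m

¬even∧odd : ∀ m → 2 ∣ m → ¬ 2 ∣ suc m
¬even∧odd m 2∣m 2∣1+m with ∣1⇒≡1 (∣m+n∣m⇒∣n (subst (2 ∣_) (+-comm 1 m) 2∣1+m) 2∣m)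
... | ()

isEven-true : ∀ {m} → 2 ∣ m → isEven m ≡ true
isEven-true {m} = dec-true (2 ∣? m)

isEven-false : ∀ {m} → 2 ∣ suc m → isEven m ≡ false
isEven-false {m} 2∣1+m = dec-false (2 ∣? m) (λ 2∣m → ¬even∧odd m 2∣m 2∣1+m)

isEven-suc : ∀ m → isEven (suc m) ≡ not (isEven m)
isEven-suc m with even-or-odd m
... | inj₁ 2∣m   = trans (dec-false (2 ∣? suc m) (¬even∧odd m 2∣m)) (cong not (sym (isEven-true 2∣m)))
... | inj₂ 2∣1+m = trans (isEven-true 2∣1+m) (cong not (sym (isEven-false 2∣1+m)))

2∣⟦isEven⟧* : ∀ m → 2 ∣ ⟦ isEven m ⟧ * m
2∣⟦isEven⟧* m with even-or-odd m
... | inj₁ 2∣m   = ∣n⇒∣m*n ⟦ isEven m ⟧ 2∣m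
... | inj₂ 2∣1+m = subst (λ b → 2 ∣ ⟦ b ⟧ * m) (sym (isEven-false 2∣1+m)) (divides 0 refl)

2∣m+m : ∀ m → 2 ∣ m + m
2∣m+m m = divides m (sym (trans (*-suc m 1) (cong (m +_) (*-identityʳ m))))

∑-even : ∀ {n} (g : Fin n → ℕ) → (∀ j → 2 ∣ g j) → 2 ∣ ∑[ j < n ] g j
∑-even {zero}  g even = divides 0 refl
∑-even {suc n} g even = ∣m∣n⇒∣m+n (even zero) (∑-even (λ j → g (suc j)) (λ j → even (suc j)))

handshake : ∀ {n} (g : Fin n → Fin n → ℕ) → (∀ v w → g v w ≡ g w v) → (∀ v → g v v ≡ 0) →
            2 ∣ ∑[ v < n ] ∑[ w < n ] g v w
handshake {zero}  g g-sym g-irr = divides 0 refl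
handshake {suc n} g g-sym g-irr =
  subst (2 ∣_) (sym split) (∣m∣n⇒∣m+n (2∣m+m row)
    (handshake (λ v w → g (suc v) (suc w)) (λ v w → g-sym (suc v) (suc w)) (λ v → g-irr (suc v))))
  where
  open ≡-Reasoning
  row rest : ℕ
  row  = ∑[ w < n ] g zero (suc w)
  rest = ∑[ v < n ] ∑[ w < n ] g (suc v) (suc w)
  split : ∑[ v < suc n ] ∑[ w < suc n ] g v w ≡ (row + row) + rest
  split = begin
    (g zero zero + row) + ∑[ v < n ] (g (suc v) zero + ∑[ w < n ] g (suc v) (suc w))
      ≡⟨ cong₂ _+_ (cong (_+ row) (g-irr zero)) (∑-distrib-+ (λ v → g (suc v) zero) _) ⟩
    row + (∑[ v < n ] g (suc v) zero + rest)
      ≡⟨ cong (λ s → row + (s + rest)) (sum-cong-≗ (λ v → g-sym (suc v) zero)) ⟩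
    row + (row + rest)
      ≡⟨ sym (+-assoc row row rest) ⟩
    (row + row) + rest ∎

∑-select : ∀ {n} (g : ℕ → ℕ) d → d < n → ∑[ i < n ] (g (toℕ i) * ⟦ does (d ≟ toℕ i) ⟧) ≡ g d
∑-select {suc n} g zero _ = begin
  g 0 * 1 + ∑[ i < n ] (g (suc (toℕ i)) * 0)
    ≡⟨ cong₂ _+_ (*-identityʳ (g 0)) (sum-cong-≗ {n} (λ i → *-zeroʳ (g (suc (toℕ i))))) ⟩
  g 0 + ∑[ i < n ] 0
    ≡⟨ cong (g 0 +_) (sum-replicate-zero n) ⟩
  g 0 + 0
    ≡⟨ +-identityʳ (g 0) ⟩
  g 0 ∎
  where open ≡-Reasoning
∑-select {suc n} g (suc d) (s≤s d<n) =
  cong₂ _+_ (*-zeroʳ (g 0)) (∑-select (λ i → g (suc i)) d d<n)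

∑-histogram : ∀ {m n} (g : ℕ → ℕ) (a d : Fin m → ℕ) → (∀ w → d w < n) →
  ∑[ i < n ] (g (toℕ i) * ∑[ w < m ] (a w * ⟦ does (d w ≟ toℕ i) ⟧)) ≡ ∑[ w < m ] (a w * g (d w))
∑-histogram {m} {n} g a d d<n = begin
  ∑[ i < n ] (g (toℕ i) * ∑[ w < m ] (a w * δ w i))
    ≡⟨ sum-cong-≗ (λ i → *-distribˡ-sum (g (toℕ i)) (λ w → a w * δ w i)) ⟩
  ∑[ i < n ] ∑[ w < m ] (g (toℕ i) * (a w * δ w i))
    ≡⟨ ∑-comm (λ i w → g (toℕ i) * (a w * δ w i)) ⟩
  ∑[ w < m ] ∑[ i < n ] (g (toℕ i) * (a w * δ w i))
    ≡⟨ sum-cong-≗ (λ w → sum-cong-≗ (λ i → x∙yz≈y∙xz (g (toℕ i)) (a w) (δ w i))) ⟩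
  ∑[ w < m ] ∑[ i < n ] (a w * (g (toℕ i) * δ w i))
    ≡⟨ sum-cong-≗ (λ w → sym (*-distribˡ-sum (a w) (λ i → g (toℕ i) * δ w i))) ⟩
  ∑[ w < m ] (a w * ∑[ i < n ] (g (toℕ i) * δ w i))
    ≡⟨ sum-cong-≗ (λ w → cong (a w *_) (∑-select g (d w) (d<n w))) ⟩
  ∑[ w < m ] (a w * g (d w)) ∎
  where
  open ≡-Reasoning
  δ : Fin m → Fin n → ℕ
  δ w i = ⟦ does (d w ≟ toℕ i) ⟧

sum-tabulate : ∀ {n} (g : Fin n → ℕ) → sum (tabulate g) ≡ ∑[ j < n ] g j
sum-tabulate {zero}  g = refl
sum-tabulate {suc n} g = cong (g zero +_) (sum-tabulate (λ j → g (suc j)))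

sum-map-allFin : ∀ {n} (g : Fin n → ℕ) → sum (map g (allFin n)) ≡ ∑[ j < n ] g j
sum-map-allFin {n} g = trans (cong sum (map-tabulate (λ j → j) g)) (sum-tabulate g)

sumOver-∑ : ∀ {n} (p : Fin n → Bool) (g : Fin n → ℕ) → sumOver p g ≡ ∑[ j < n ] (⟦ p j ⟧ * g j)
sumOver-∑ p g = trans (sum-map-allFin (λ j → if p j then g j else 0))
                      (sum-cong-≗ (λ j → if-then-0≡⟦⟧* (p j) (g j)))

sum-applyUpTo : ∀ (g : ℕ → ℕ) n → sum (applyUpTo g n) ≡ ∑[ i < n ] g (toℕ i)
sum-applyUpTo g zero    = refl
sum-applyUpTo g (suc n) = cong (g 0 +_) (sum-applyUpTo (λ i → g (suc i)) n)

sec-applyUpTo : ∀ (g : ℕ → ℕ) n → sec (applyUpTo g n) ≡ ∑[ i < n ] (⟦ isEven (toℕ i) ⟧ * g (toℕ i))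
soc-applyUpTo : ∀ (g : ℕ → ℕ) n → soc (applyUpTo g n) ≡ ∑[ i < n ] (⟦ not (isEven (toℕ i)) ⟧ * g (toℕ i))
sec-applyUpTo g zero    = refl
sec-applyUpTo g (suc n) = cong₂ _+_ (sym (+-identityʳ (g 0))) (begin
  soc (applyUpTo (λ i → g (suc i)) n)
    ≡⟨ soc-applyUpTo (λ i → g (suc i)) n ⟩
  ∑[ i < n ] (⟦ not (isEven (toℕ i)) ⟧ * g (suc (toℕ i)))
    ≡⟨ sum-cong-≗ {n} (λ i → cong (λ b → ⟦ b ⟧ * g (suc (toℕ i))) (sym (isEven-suc (toℕ i)))) ⟩
  ∑[ i < n ] (⟦ isEven (suc (toℕ i)) ⟧ * g (suc (toℕ i))) ∎)
  where open ≡-Reasoning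
soc-applyUpTo g zero    = refl
soc-applyUpTo g (suc n) = begin
  sec (applyUpTo (λ i → g (suc i)) n)
    ≡⟨ sec-applyUpTo (λ i → g (suc i)) n ⟩
  ∑[ i < n ] (⟦ isEven (toℕ i) ⟧ * g (suc (toℕ i)))
    ≡⟨ sum-cong-≗ {n} (λ i → cong (λ b → ⟦ b ⟧ * g (suc (toℕ i))) (not-isEven-suc (toℕ i))) ⟩
  ∑[ i < n ] (⟦ not (isEven (suc (toℕ i))) ⟧ * g (suc (toℕ i))) ∎
  where
  open ≡-Reasoning
  not-isEven-suc : ∀ m → isEven m ≡ not (isEven (suc m))
  not-isEven-suc m = trans (sym (not-involutive (isEven m))) (cong not (sym (isEven-suc m)))

coeff-applyUpTo : ∀ (g : ℕ → ℕ) {n i} → i < n → coeff (applyUpTo g n) i ≡ g i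
coeff-applyUpTo g {suc n} {zero}  _         = refl
coeff-applyUpTo g {suc n} {suc i} (s≤s i<n) = coeff-applyUpTo (λ k → g (suc k)) i<n

coeff-applyUpTo-≥ : ∀ (g : ℕ → ℕ) {n i} → n ≤ i → coeff (applyUpTo g n) i ≡ 0
coeff-applyUpTo-≥ g {zero}          _         = refl
coeff-applyUpTo-≥ g {suc n} {suc i} (s≤s n≤i) = coeff-applyUpTo-≥ (λ k → g (suc k)) n≤i

length-filter-sum : ∀ {A : Set} {P : A → Set} (P? : Decidable P) (xs : List A) →
                    length (filter P? xs) ≡ sum (map (λ x → ⟦ does (P? x) ⟧) xs)
length-filter-sum P? []       = refl
length-filter-sum P? (x ∷ xs) with does (P? x)
... | true  = cong suc (length-filter-sum P? xs)
... | false = length-filter-sum P? xs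

sum-map-filter : ∀ {A : Set} {P : A → Set} (P? : Decidable P) (f : A → ℕ) (xs : List A) →
                 sum (map f (filter P? xs)) ≡ sum (map (λ x → ⟦ does (P? x) ⟧ * f x) xs)
sum-map-filter P? f []       = refl
sum-map-filter P? f (x ∷ xs) with does (P? x)
... | true  = cong₂ _+_ (sym (+-identityʳ (f x))) (sum-map-filter P? f xs)
... | false = sum-map-filter P? f xs

lookup-injective : ∀ {A : Set} {xs : List A} → Unique xs → Injective _≡_ _≡_ (lookup xs)
lookup-injective {xs = x ∷ xs} _          {zero}  {zero}  _  = refl
lookup-injective {xs = x ∷ xs} (x∉xs ∷ _) {zero}  {suc j} eq = ⊥-elim (All.lookup x∉xs (∈-lookup j) eq)
lookup-injective {xs = x ∷ xs} (x∉xs ∷ _) {suc i} {zero}  eq = ⊥-elim (All.lookup x∉xs (∈-lookup i) (sym eq))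
lookup-injective {xs = x ∷ xs} (_ ∷ u)    {suc i} {suc j} eq = cong suc (lookup-injective u eq)

enumerate-unique : ∀ {A : Set} {xs : List A} {k} → Unique xs → length xs ≡ k →
                   Σ (Fin k → A) λ f → Injective _≡_ _≡_ f × (∀ t → f t ∈ xs)
enumerate-unique {xs = xs} u refl = lookup xs , lookup-injective u , ∈-lookup

module _ {n : ℕ} (G : SimpleGraph n) where

  adjacency : Fin n → Fin n → ℕ
  adjacency v w = ⟦ adj G v w ⟧

  adjacency-sym : ∀ v w → adjacency v w ≡ adjacency w v
  adjacency-sym v w = cong ⟦_⟧ (adj-sym G v w)

  adjacency-irrefl : ∀ v → adjacency v v ≡ 0
  adjacency-irrefl v = cong ⟦_⟧ (adj-irrefl G v)

  degree-∑ : ∀ v → degree G v ≡ ∑[ w < n ] adjacency v w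
  degree-∑ v = trans (length-filter-sum (λ w → T? (adj G v w)) (allFin n)) (sum-map-allFin (adjacency v))

  degree<n : ∀ v → degree G v < n
  degree<n v = subst (degree G v <_) (length-tabulate (λ w → w))
    (filter-notAll (λ w → T? (adj G v w)) (allFin n) (Any.map (λ { refl → no-loop }) (∈-allFin v)))
    where
    no-loop : ¬ T (adj G v v)
    no-loop = subst T (adj-irrefl G v)

  neighboursOfDegree : Fin n → ℕ → List (Fin n)
  neighboursOfDegree v i = filter (λ w → degree G w ≟ i) (neighbours G v)

  length-neighboursOfDegree : ∀ v k →
    length (neighboursOfDegree v k) ≡ ∑[ w < n ] (adjacency v w * ⟦ does (degree G w ≟ k) ⟧)
  length-neighboursOfDegree v k = begin
    length (neighboursOfDegree v k)
      ≡⟨ length-filter-sum (λ w → degree G w ≟ k) (neighbours G v) ⟩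
    sum (map (λ w → ⟦ does (degree G w ≟ k) ⟧) (neighbours G v))
      ≡⟨ sum-map-filter (λ w → T? (adj G v w)) (λ w → ⟦ does (degree G w ≟ k) ⟧) (allFin n) ⟩
    sum (map (λ w → adjacency v w * ⟦ does (degree G w ≟ k) ⟧) (allFin n))
      ≡⟨ sum-map-allFin (λ w → adjacency v w * ⟦ does (degree G w ≟ k) ⟧) ⟩
    ∑[ w < n ] (adjacency v w * ⟦ does (degree G w ≟ k) ⟧) ∎
    where open ≡-Reasoning

  dp-applyUpTo : ∀ v → dp G v ≡ applyUpTo (λ k → length (neighboursOfDegree v k)) n
  dp-applyUpTo v = map-upTo (λ k → length (neighboursOfDegree v k)) n

  ∑-weighted-dp : ∀ (g : ℕ → ℕ) v →
    ∑[ i < n ] (g (toℕ i) * length (neighboursOfDegree v (toℕ i))) ≡ ∑[ w < n ] (adjacency v w * g (degree G w))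
  ∑-weighted-dp g v =
    trans (sum-cong-≗ {n} (λ i → cong (g (toℕ i) *_) (length-neighboursOfDegree v (toℕ i))))
          (∑-histogram g (adjacency v) (degree G) degree<n)

  sc-dp : ∀ v → sc (dp G v) ≡ degree G v
  sc-dp v = begin
    sum (dp G v)                                   ≡⟨ cong sum (dp-applyUpTo v) ⟩
    sum (applyUpTo c n)                            ≡⟨ sum-applyUpTo c n ⟩
    ∑[ i < n ] c (toℕ i)                           ≡⟨ sum-cong-≗ {n} (λ i → sym (+-identityʳ (c (toℕ i)))) ⟩
    ∑[ i < n ] (1 * c (toℕ i))                     ≡⟨ ∑-weighted-dp (λ _ → 1) v ⟩
    ∑[ w < n ] (adjacency v w * 1)                 ≡⟨ sum-cong-≗ {n} (λ w → *-identityʳ (adjacency v w)) ⟩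
    ∑[ w < n ] adjacency v w                       ≡⟨ sym (degree-∑ v) ⟩
    degree G v ∎
    where
    open ≡-Reasoning
    c : ℕ → ℕ
    c k = length (neighboursOfDegree v k)

  neighboursIn : (Fin n → Bool) → Fin n → ℕ
  neighboursIn P v = ∑[ w < n ] (adjacency v w * ⟦ P w ⟧)

  evenDegree : Fin n → Bool
  evenDegree v = isEven (degree G v)

  sec-dp : ∀ v → sec (dp G v) ≡ neighboursIn evenDegree v
  sec-dp v = begin
    sec (dp G v)                           ≡⟨ cong sec (dp-applyUpTo v) ⟩
    sec (applyUpTo c n)                    ≡⟨ sec-applyUpTo c n ⟩
    ∑[ i < n ] (⟦ isEven (toℕ i) ⟧ * c (toℕ i)) ≡⟨ ∑-weighted-dp (λ k → ⟦ isEven k ⟧) v ⟩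
    neighboursIn evenDegree v ∎
    where
    open ≡-Reasoning
    c : ℕ → ℕ
    c k = length (neighboursOfDegree v k)

  degree-split : ∀ P v → degree G v ≡ neighboursIn P v + neighboursIn (λ w → not (P w)) v
  degree-split P v = begin
    degree G v
      ≡⟨ degree-∑ v ⟩
    ∑[ w < n ] adjacency v w
      ≡⟨ sum-cong-≗ {n} (λ w → split (adjacency v w) (P w)) ⟩
    ∑[ w < n ] (adjacency v w * ⟦ P w ⟧ + adjacency v w * ⟦ not (P w) ⟧)
      ≡⟨ ∑-distrib-+ (λ w → adjacency v w * ⟦ P w ⟧) (λ w → adjacency v w * ⟦ not (P w) ⟧) ⟩
    neighboursIn P v + neighboursIn (λ w → not (P w)) v ∎
    where
    open ≡-Reasoning
    split : ∀ x b → x ≡ x * ⟦ b ⟧ + x * ⟦ not b ⟧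
    split x b = trans (⟦⟧*-split b x) (cong₂ _+_ (*-comm ⟦ b ⟧ x) (*-comm ⟦ not b ⟧ x))

  degree-sum-even : 2 ∣ ∑[ v < n ] degree G v
  degree-sum-even = subst (2 ∣_) (sym (sum-cong-≗ {n} degree-∑))
    (handshake adjacency adjacency-sym adjacency-irrefl)

  induced-edge-sum-even : ∀ P → 2 ∣ ∑[ v < n ] (⟦ P v ⟧ * neighboursIn P v)
  induced-edge-sum-even P = subst (2 ∣_) (sum-cong-≗ {n} (λ v → sym (*-distribˡ-sum ⟦ P v ⟧ (λ w → adjacency v w * ⟦ P w ⟧))))
    (handshake (λ v w → ⟦ P v ⟧ * (adjacency v w * ⟦ P w ⟧)) induced-sym induced-irrefl)
    where
    induced-sym : ∀ v w → ⟦ P v ⟧ * (adjacency v w * ⟦ P w ⟧) ≡ ⟦ P w ⟧ * (adjacency w v * ⟦ P v ⟧)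
    induced-sym v w = trans (x∙yz≈z∙yx ⟦ P v ⟧ (adjacency v w) ⟦ P w ⟧)
                            (cong (λ a → ⟦ P w ⟧ * (a * ⟦ P v ⟧)) (adjacency-sym v w))
    induced-irrefl : ∀ v → ⟦ P v ⟧ * (adjacency v v * ⟦ P v ⟧) ≡ 0
    induced-irrefl v = trans (cong (λ a → ⟦ P v ⟧ * (a * ⟦ P v ⟧)) (adjacency-irrefl v)) (*-zeroʳ ⟦ P v ⟧)

  odd-degree-sum-even : 2 ∣ ∑[ v < n ] (⟦ not (evenDegree v) ⟧ * degree G v)
  odd-degree-sum-even = ∣m+n∣m⇒∣n (subst (2 ∣_) split degree-sum-even) (∑-even (λ v → ⟦ evenDegree v ⟧ * degree G v) (λ v → 2∣⟦isEven⟧* (degree G v)))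
    where
    split : ∑[ v < n ] degree G v
          ≡ ∑[ v < n ] (⟦ evenDegree v ⟧ * degree G v) + ∑[ v < n ] (⟦ not (evenDegree v) ⟧ * degree G v)
    split = trans (sum-cong-≗ {n} (λ v → ⟦⟧*-split (evenDegree v) (degree G v)))
                  (∑-distrib-+ (λ v → ⟦ evenDegree v ⟧ * degree G v) (λ v → ⟦ not (evenDegree v) ⟧ * degree G v))

  cut-edge-sum-even : ∀ P → 2 ∣ ∑[ v < n ] (⟦ not (P v) ⟧ * degree G v) →
                      2 ∣ ∑[ v < n ] (⟦ not (P v) ⟧ * neighboursIn P v)
  cut-edge-sum-even P 2∣∑deg =
    ∣m+n∣m⇒∣n (subst (2 ∣_) split 2∣∑deg) (induced-edge-sum-even Q)
    where
    Q : Fin n → Bool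
    Q v = not (P v)
    split : ∑[ v < n ] (⟦ Q v ⟧ * degree G v)
          ≡ ∑[ v < n ] (⟦ Q v ⟧ * neighboursIn Q v) + ∑[ v < n ] (⟦ Q v ⟧ * neighboursIn P v)
    split = trans (sum-cong-≗ {n} (λ v → begin
        ⟦ Q v ⟧ * degree G v
          ≡⟨ cong (⟦ Q v ⟧ *_) (trans (degree-split P v) (+-comm (neighboursIn P v) _)) ⟩
        ⟦ Q v ⟧ * (neighboursIn Q v + neighboursIn P v)
          ≡⟨ *-distribˡ-+ ⟦ Q v ⟧ (neighboursIn Q v) (neighboursIn P v) ⟩
        ⟦ Q v ⟧ * neighboursIn Q v + ⟦ Q v ⟧ * neighboursIn P v ∎))
      (∑-distrib-+ (λ v → ⟦ Q v ⟧ * neighboursIn Q v) (λ v → ⟦ Q v ⟧ * neighboursIn P v))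
      where open ≡-Reasoning

  ∈-neighboursOfDegree⁻ : ∀ {v i w} → w ∈ neighboursOfDegree v i → T (adj G v w) × degree G w ≡ i
  ∈-neighboursOfDegree⁻ {v} {i} w∈ with ∈-filter⁻ (λ w → degree G w ≟ i) {xs = neighbours G v} w∈
  ... | w∈N , deg≡i = proj₂ (∈-filter⁻ (λ w → T? (adj G v w)) {xs = allFin n} w∈N) , deg≡i

  neighboursOfDegree-unique : ∀ v i → Unique (neighboursOfDegree v i)
  neighboursOfDegree-unique v i =
    filter⁺ (λ w → degree G w ≟ i) (filter⁺ (λ w → T? (adj G v w)) (allFin⁺ n))

  coeff-dp : ∀ v {i} → i < n → coeff (dp G v) i ≡ length (neighboursOfDegree v i)
  coeff-dp v i<n = trans (cong (λ f → coeff f _) (dp-applyUpTo v)) (coeff-applyUpTo _ i<n)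

  coeff-dp-≥ : ∀ v {i} → n ≤ i → coeff (dp G v) i ≡ 0
  coeff-dp-≥ v n≤i = trans (cong (λ f → coeff f _) (dp-applyUpTo v)) (coeff-applyUpTo-≥ _ n≤i)

  dp-coefficient-witnesses : ∀ v i → coeff (dp G v) i ≢ 0 →
    Σ (Fin (coeff (dp G v) i) → Fin n) λ w →
      Injective _≡_ _≡_ w × (∀ t → w t ≢ v) × (∀ t → sc (dp G (w t)) ≡ i)
  dp-coefficient-witnesses v i coeff≢0 with i <? n
  ... | no i≮n = ⊥-elim (coeff≢0 (coeff-dp-≥ v (≮⇒≥ i≮n)))
  ... | yes i<n with enumerate-unique (neighboursOfDegree-unique v i) (sym (coeff-dp v i<n))
  ... | w , w-injective , w∈ =
    w , w-injective , (λ t → not-loop (proj₁ (∈-neighboursOfDegree⁻ (w∈ t))))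
      , (λ t → trans (sc-dp (w t)) (proj₂ (∈-neighboursOfDegree⁻ (w∈ t))))
    where
    not-loop : ∀ {u} → T (adj G v u) → u ≢ v
    not-loop adj-vu refl = subst T (adj-irrefl G v) adj-vu

  sum-sc-dp : sum (map (λ j → sc (dp G j)) (allFin n)) ≡ ∑[ v < n ] degree G v
  sum-sc-dp = trans (sum-map-allFin (λ j → sc (dp G j))) (sum-cong-≗ {n} sc-dp)

  sumOver-sec-dp : ∀ (p : ℕ → Bool) → sumOver (λ j → p (sc (dp G j))) (λ j → sec (dp G j))
                 ≡ ∑[ v < n ] (⟦ p (degree G v) ⟧ * neighboursIn evenDegree v)
  sumOver-sec-dp p = trans (sumOver-∑ (λ j → p (sc (dp G j))) (λ j → sec (dp G j)))
    (sum-cong-≗ {n} (λ v → cong₂ (λ d s → ⟦ p d ⟧ * s) (sc-dp v) (sec-dp v)))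

theorem4p12 : ∀ (n : ℕ) (G : SimpleGraph n) → NoIsolated G →
    (2 ∣ sum (map (λ j → sc (dp G j)) (allFin n)))
    × (∀ (v : Fin n) (i : ℕ) → coeff (dp G v) i ≢ 0 →
         Σ (Fin (coeff (dp G v) i) → Fin n) λ w →
           Injective _≡_ _≡_ w
           × (∀ t → w t ≢ v)
           × (∀ t → sc (dp G (w t)) ≡ i))
    × (2 ∣ sumOver (λ j → not (isEven (sc (dp G j)))) (λ j → sec (dp G j)))
    × (2 ∣ sumOver (λ j → isEven (sc (dp G j))) (λ j → sec (dp G j)))
theorem4p12 n G _ =
    subst (2 ∣_) (sym (sum-sc-dp G)) (degree-sum-even G)
  , dp-coefficient-witnesses G
  , subst (2 ∣_) (sym (sumOver-sec-dp G (not ∘ isEven)))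
          (cut-edge-sum-even G (evenDegree G) (odd-degree-sum-even G))
  , subst (2 ∣_) (sym (sumOver-sec-dp G isEven)) (induced-edge-sum-even G (evenDegree G))
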